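{- Let $p=3$, $k=2$, $e\ge1$, and $n=3^{l_1}+3^{l_2}+3^{l_3}$ where $l_1,l_2,l_3$ are positive integers. Then $D_{n,2}(1,x)$ is a permutation polynomial of $\mathbb{F}_{3^e}$ if and only if \[g(x)=x^{\frac{3^{l_1}+3^{l_2}+3^{l_3}-1}{2}}+x^{\frac{3^{l_1}-1}{2}}+x^{\frac{3^{l_2}-1}{2}}+x^{\frac{3^{l_3}-1}{2}}\] is a permutation polynomial of $\mathbb{F}_{3^e}$.
   Context: For an odd prime $p$ and $0\le k\le p-1$: for $n\ge 1$, $D_{n,k}(1,x)=\sum_{i=0}^{\lfloor n/2\rfloor}\frac{n-ki}{n-i}\binom{n-i}{i}(-x)^i$, where the coefficient is the integer $\binom{n-i}{i}-(k-1)\binom{n-i-1}{i-1}$ (with $\binom{m}{ -1}=0$) viewed in $\mathbb{F}_p$; $D_{0,k}(1,x)=2-k$. Equivalently $D_{1,k}=1$ and $D_{n,k}=D_{n-1,k}-xD_{n-2,k}$ for $n\ge2$. A polynomial over $\mathbb{F}_q$ is a permutation polynomial of $\mathbb{F}_q$ if it induces a bijection of $\mathbb{F}_q$. -}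

module Defs where

open import Level using (Level; _⊔_)
open import Data.Nat as ℕ using (ℕ; zero; suc)
open import Data.Nat.DivMod as ℕ using (_/_)
open import Data.Fin using (Fin)
open import Data.Product using (Σ; _×_; ∃)
open import Relation.Nullary using (¬_)
open import Relation.Binary.PropositionalEquality as ≡ using ()
open import Algebra.Bundles using (CommutativeRing)
open import Function.Bundles using (Inverse)
open import Function.Definitions using (Bijective)

record IsField {c ℓ : Level} (R : CommutativeRing c ℓ) : Set (c ⊔ ℓ) where
  open CommutativeRing R
  field
    1≉0     : ¬ (1# ≈ 0#)
    inverse : ∀ x → ¬ (x ≈ 0#) → ∃ λ y → (x * y) ≈ 1#

-- A finite field with exactly q elements (q = |F|), i.e. a field whose carrier
-- setoid is in bijection with Fin q.  Any such field "is" F_q (unique up to iso).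
record FiniteFieldOfOrder (c ℓ : Level) (q : ℕ) : Set (Level.suc (c ⊔ ℓ)) where
  field
    cring   : CommutativeRing c ℓ
    isField : IsField cring
    card    : Inverse (CommutativeRing.setoid cring) (≡.setoid (Fin q))
  open CommutativeRing cring public

module _ {c ℓ : Level} {q : ℕ} (F : FiniteFieldOfOrder c ℓ q) where
  open FiniteFieldOfOrder F

  ι : ℕ → Carrier
  ι zero    = 0#
  ι (suc n) = 1# + ι n

  pow : Carrier → ℕ → Carrier
  pow x zero    = 1#
  pow x (suc m) = x * pow x m

  D : ℕ → ℕ → Carrier → Carrier
  D zero          k x = ι 2 - ι k
  D (suc zero)    k x = 1#
  D (suc (suc n)) k x = D (suc n) k x - (x * D n k x)

  IsPermutationPolynomial : (Carrier → Carrier) → Set (c ⊔ ℓ)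
  IsPermutationPolynomial f = Bijective _≈_ _≈_ f

  g : ℕ → ℕ → ℕ → Carrier → Carrier
  g l₁ l₂ l₃ x =
      pow x ((3 ℕ.^ l₁ ℕ.+ 3 ℕ.^ l₂ ℕ.+ 3 ℕ.^ l₃ ℕ.∸ 1) ℕ./ 2)
    + pow x ((3 ℕ.^ l₁ ℕ.∸ 1) ℕ./ 2)
    + pow x ((3 ℕ.^ l₂ ℕ.∸ 1) ℕ./ 2)
    + pow x ((3 ℕ.^ l₃ ℕ.∸ 1) ℕ./ 2)

module Submission where

-- We show the
-- pointwise identity  D_{n,2}(1,x) = g(1 - x)  on F; since x ↦ 1 - x is an
-- involution of F, D_{n,2} is a permutation of F iff g is.
--
-- The identity comes from the Binet form of D_{n,2}.  F has characteristic 3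
-- (the translation x ↦ 1 + x permutes F, so q·1 = 0, and q = 3^e forces 3·1 = 0).
-- Put y = 1 - x and α = 2 + 2√y in the formal extension F[√y], realised as
-- pairs a + b√y.  Then D_{m,2}(1,x) = 2·b_m where α^m = a_m + b_m√y, because
-- α satisfies the recurrence of D.  In characteristic 3 cubing is additive, so
-- α^{3^l} = 2 + 2·y^{(3^l-1)/2}√y, and multiplying three such powers and reading
-- off the √y-coordinate gives exactly g(y).

open import Defs
open import Level using (Level)
open import Function.Base using (_∘_)
open import Function.Bundles using (_⇔_; mk⇔; Equivalence; Inverse)
open import Function.Definitions using (Bijective; Congruent)
open import Data.Nat as ℕ using (ℕ; zero; suc; _^_; _≥_)
open import Data.Nat.DivMod using (_%_; _/_; m≡m%n+[m/n]*n; m*n/n≡m)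
open import Data.Nat.Tactic.RingSolver using (solve-∀)
open import Data.Fin as Fin using (Fin)
open import Data.Fin.Permutation using (Permutation; permutation)
open import Data.Maybe using (Maybe; just; nothing)
open import Data.Product using (_×_; _,_; proj₁; proj₂)
open import Data.Empty using (⊥-elim)
open import Relation.Nullary using (yes; no; ¬_; Dec)
open import Relation.Binary.Bundles using (Setoid)
open import Relation.Binary.PropositionalEquality as ≡ using (_≡_)
open import Algebra.Bundles using (RawRing)
import Algebra.Solver.Ring.AlmostCommutativeRing as ACR
import Function.Construct.Composition as Compose
import Function.Consequences.Setoid as FunctionConsequences

-- The exponents (3^l - 1)/2, given by the recursion h(l+1) = 3·h(l) + 1.
halfExp : ℕ → ℕ
halfExp zero    = 0
halfExp (suc l) = suc (3 ℕ.* halfExp l)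

pow3≡1+2·halfExp : ∀ l → 3 ^ l ≡ suc (halfExp l ℕ.* 2)
pow3≡1+2·halfExp zero    = ≡.refl
pow3≡1+2·halfExp (suc l) =
  ≡.trans (≡.cong (3 ℕ.*_) (pow3≡1+2·halfExp l)) (tripling (halfExp l))
  where
  tripling : ∀ h → 3 ℕ.* suc (h ℕ.* 2) ≡ suc (suc (3 ℕ.* h) ℕ.* 2)
  tripling = solve-∀

halfExp-correct : ∀ l → (3 ^ l ℕ.∸ 1) / 2 ≡ halfExp l
halfExp-correct l rewrite pow3≡1+2·halfExp l = m*n/n≡m (halfExp l) 2

odd-sum : ∀ a b c →
  a ℕ.* 2 ℕ.+ suc (b ℕ.* 2) ℕ.+ suc (c ℕ.* 2) ≡ suc (a ℕ.+ b ℕ.+ c) ℕ.* 2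
odd-sum = solve-∀

halfExp-sum : ∀ l₁ l₂ l₃ →
  (3 ^ l₁ ℕ.+ 3 ^ l₂ ℕ.+ 3 ^ l₃ ℕ.∸ 1) / 2 ≡ suc (halfExp l₁ ℕ.+ halfExp l₂ ℕ.+ halfExp l₃)
halfExp-sum l₁ l₂ l₃
  rewrite pow3≡1+2·halfExp l₁ | pow3≡1+2·halfExp l₂ | pow3≡1+2·halfExp l₃
        | odd-sum (halfExp l₁) (halfExp l₂) (halfExp l₃)
  = m*n/n≡m (suc (halfExp l₁ ℕ.+ halfExp l₂ ℕ.+ halfExp l₃)) 2

-- Splits a power α^{3n} into a cube.
three-times : ∀ n → 3 ℕ.* n ≡ n ℕ.+ (n ℕ.+ n)
three-times = solve-∀

module Bijections {a ℓ : Level} (S : Setoid a ℓ) where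
  open Setoid S renaming (Carrier to A)
  open FunctionConsequences S S using (inverseᵇ⇒bijective)

  involution-bijective : ∀ {h : A → A} → Congruent _≈_ _≈_ h →
    (∀ x → h (h x) ≈ x) → Bijective _≈_ _≈_ h
  involution-bijective {h} h-cong h∘h≈id = inverseᵇ⇒bijective (undo , undo)
    where
    undo : ∀ {x z} → z ≈ h x → h z ≈ x
    undo {x} z≈hx = trans (h-cong z≈hx) (h∘h≈id x)

  bijective-resp-≗ : ∀ {f f′ : A → A} → (∀ x → f x ≈ f′ x) →
    Bijective _≈_ _≈_ f ⇔ Bijective _≈_ _≈_ f′
  bijective-resp-≗ f≈f′ = mk⇔ (transport f≈f′) (transport (sym ∘ f≈f′))
    where
    transport : ∀ {f f′ : A → A} → (∀ x → f x ≈ f′ x) →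
      Bijective _≈_ _≈_ f → Bijective _≈_ _≈_ f′
    transport f≈f′ (inj , surj) =
      (λ {x} {z} e → inj (trans (f≈f′ x) (trans e (sym (f≈f′ z))))) ,
      (λ w → proj₁ (surj w) , λ z≈u → trans (sym (f≈f′ _)) (proj₂ (surj w) z≈u))

  bijective-∘-involution : ∀ {f h : A → A} →
    Congruent _≈_ _≈_ f → Congruent _≈_ _≈_ h → (∀ x → h (h x) ≈ x) →
    Bijective _≈_ _≈_ (f ∘ h) ⇔ Bijective _≈_ _≈_ f
  bijective-∘-involution {f} {h} f-cong h-cong h∘h≈id = mk⇔
    (λ f∘h-bij → Equivalence.to (bijective-resp-≗ (f-cong ∘ h∘h≈id))
                   (Compose.bijective _≈_ _≈_ _≈_ h-bij f∘h-bij))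
    (Compose.bijective _≈_ _≈_ _≈_ h-bij)
    where
    h-bij : Bijective _≈_ _≈_ h
    h-bij = involution-bijective h-cong h∘h≈id

module FieldFacts {c ℓ : Level} {q : ℕ} (F : FiniteFieldOfOrder c ℓ q) where
  open FiniteFieldOfOrder F
  open import Relation.Binary.Reasoning.Setoid setoid
  open import Algebra.Properties.CommutativeMonoid.Sum +-commutativeMonoid
    using (sum; sum-permute; sum-cong-≋)
  open import Algebra.Properties.CommutativeSemigroup +-commutativeSemigroup
    using (interchange)

  ι-+ : ∀ m n → ι F (m ℕ.+ n) ≈ ι F m + ι F n
  ι-+ zero    n = sym (+-identityˡ _)
  ι-+ (suc m) n = trans (+-congˡ (ι-+ m n)) (sym (+-assoc _ _ _))

  ι-* : ∀ m n → ι F (m ℕ.* n) ≈ ι F m * ι F n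
  ι-* zero    n = sym (zeroˡ _)
  ι-* (suc m) n = begin
    ι F (n ℕ.+ m ℕ.* n)          ≈⟨ ι-+ n (m ℕ.* n) ⟩
    ι F n + ι F (m ℕ.* n)        ≈⟨ +-cong (sym (*-identityˡ _)) (ι-* m n) ⟩
    1# * ι F n + ι F m * ι F n   ≈⟨ sym (distribʳ _ _ _) ⟩
    (1# + ι F m) * ι F n         ∎

  pow-cong : ∀ {a b} m → a ≈ b → pow F a m ≈ pow F b m
  pow-cong zero    a≈b = refl
  pow-cong (suc m) a≈b = *-cong a≈b (pow-cong m a≈b)

  pow-+ : ∀ a m n → pow F a (m ℕ.+ n) ≈ pow F a m * pow F a n
  pow-+ a zero    n = sym (*-identityˡ _)
  pow-+ a (suc m) n = trans (*-congˡ (pow-+ a m n)) (sym (*-assoc _ _ _))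

  ι-^ : ∀ m e → ι F (m ^ e) ≈ pow F (ι F m) e
  ι-^ m zero    = +-identityʳ _
  ι-^ m (suc e) = trans (ι-* m (m ^ e)) (*-congˡ (ι-^ m e))

  g-cong : ∀ l₁ l₂ l₃ → Congruent _≈_ _≈_ (g F l₁ l₂ l₃)
  g-cong l₁ l₂ l₃ a≈b =
    +-cong (+-cong (+-cong (pow-cong ((3 ^ l₁ ℕ.+ 3 ^ l₂ ℕ.+ 3 ^ l₃ ℕ.∸ 1) / 2) a≈b)
                           (pow-cong (half l₁) a≈b))
                   (pow-cong (half l₂) a≈b))
           (pow-cong (half l₃) a≈b)
    where
    half : ℕ → ℕ
    half l = (3 ^ l ℕ.∸ 1) / 2

  -- A field has no zero divisors, so powers of nonzero elements are nonzero.
  pow-nonzero : ∀ t → ¬ (t ≈ 0#) → ∀ k → ¬ (pow F t k ≈ 0#)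
  pow-nonzero t t≉0 zero    1≈0 = IsField.1≉0 isField 1≈0
  pow-nonzero t t≉0 (suc k) tᵏ⁺¹≈0 with IsField.inverse isField t t≉0
  ... | u , tu≈1 = pow-nonzero t t≉0 k (begin
    pow F t k              ≈⟨ sym (*-identityˡ _) ⟩
    1# * pow F t k         ≈⟨ *-congʳ (trans (sym tu≈1) (*-comm t u)) ⟩
    (u * t) * pow F t k    ≈⟨ *-assoc _ _ _ ⟩
    u * pow F t (suc k)    ≈⟨ *-congˡ tᵏ⁺¹≈0 ⟩
    u * 0#                 ≈⟨ zeroʳ _ ⟩
    0#                     ∎)

  module Card = Inverse card

  from∘to : ∀ a → Card.from (Card.to a) ≈ a
  from∘to a = Card.inverseʳ ≡.refl

  -- Equality in F is decidable, by transport along the bijection with Fin q.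
  _≟_ : ∀ a b → Dec (a ≈ b)
  a ≟ b with Card.to a Fin.≟ Card.to b
  ... | yes e = yes (trans (sym (from∘to a)) (trans (Card.from-cong e) (from∘to b)))
  ... | no ne = no (ne ∘ Card.to-cong)

  sum-shift : ∀ {n} (f : Fin n → Carrier) → sum (λ i → 1# + f i) ≈ ι F n + sum f
  sum-shift {zero}  f = sym (+-identityʳ _)
  sum-shift {suc n} f =
    trans (+-congˡ (sum-shift (f ∘ Fin.suc))) (interchange _ _ _ _)

  translation : Permutation q q
  translation = permutation (shift 1#) (shift (- 1#))
    (λ i → Card.inverseˡ (cancel (-‿inverseʳ 1#)))
    (λ i → Card.inverseˡ (cancel (-‿inverseˡ 1#)))
    where
    shift : Carrier → Fin q → Fin q
    shift s i = Card.to (s + Card.from i)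
    cancel : ∀ {s t a} → s + t ≈ 0# → s + Card.from (Card.to (t + a)) ≈ a
    cancel {s} {t} {a} s+t≈0 = begin
      s + Card.from (Card.to (t + a))  ≈⟨ +-congˡ (from∘to _) ⟩
      s + (t + a)                      ≈⟨ sym (+-assoc _ _ _) ⟩
      (s + t) + a                      ≈⟨ +-congʳ s+t≈0 ⟩
      0# + a                           ≈⟨ +-identityˡ _ ⟩
      a                                ∎

  -- q·1 = 0: summing all elements before and after translating by 1.
  ι-order : ι F q ≈ 0#
  ι-order = begin
    ι F q                  ≈⟨ sym (+-identityʳ _) ⟩
    ι F q + 0#             ≈⟨ +-congˡ (sym (-‿inverseʳ S)) ⟩
    ι F q + (S + - S)      ≈⟨ sym (+-assoc _ _ _) ⟩
    (ι F q + S) + - S      ≈⟨ +-congʳ (sym S≈q+S) ⟩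
    S + - S                ≈⟨ -‿inverseʳ S ⟩
    0#                     ∎
    where
    S : Carrier
    S = sum Card.from
    S≈q+S : S ≈ ι F q + S
    S≈q+S = trans (sum-permute Card.from translation)
      (trans (sum-cong-≋ (λ i → from∘to (1# + Card.from i))) (sum-shift Card.from))

  characteristic : ∀ m e → q ≡ m ^ e → ι F m ≈ 0#
  characteristic m e q≡mᵉ with ι F m ≟ 0#
  ... | yes m≈0 = m≈0
  ... | no  m≉0 = ⊥-elim (pow-nonzero (ι F m) m≉0 e
        (trans (sym (ι-^ m e)) (≡.subst (λ k → ι F k ≈ 0#) q≡mᵉ ι-order)))

module Characteristic3 {a ℓ : Level} {q : ℕ} (F : FiniteFieldOfOrder a ℓ q)
  (ι3≈0 : FiniteFieldOfOrder._≈_ F (ι F 3) (FiniteFieldOfOrder.0# F)) where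
  open FiniteFieldOfOrder F
  open FieldFacts F
  open import Relation.Binary.Reasoning.Setoid setoid

  ι-%3 : ∀ n → ι F (n % 3) ≈ ι F n
  ι-%3 n = sym (begin
    ι F n                                ≡⟨ ≡.cong (ι F) (m≡m%n+[m/n]*n n 3) ⟩
    ι F (n % 3 ℕ.+ (n / 3) ℕ.* 3)        ≈⟨ ι-+ (n % 3) _ ⟩
    ι F (n % 3) + ι F ((n / 3) ℕ.* 3)    ≈⟨ +-congˡ (ι-* (n / 3) 3) ⟩
    ι F (n % 3) + ι F (n / 3) * ι F 3    ≈⟨ +-congˡ (trans (*-congˡ ι3≈0) (zeroʳ _)) ⟩
    ι F (n % 3) + 0#                     ≈⟨ +-identityʳ _ ⟩
    ι F (n % 3)                          ∎)

  -- 2n·1 = -(n·1), since 3n·1 = 0.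
  ι-double : ∀ n → ι F (n ℕ.+ n) ≈ - ι F n
  ι-double n = begin
    ι F (n ℕ.+ n)                        ≈⟨ sym (+-identityʳ _) ⟩
    ι F (n ℕ.+ n) + 0#                   ≈⟨ +-congˡ (sym (-‿inverseʳ (ι F n))) ⟩
    ι F (n ℕ.+ n) + (ι F n + - ι F n)    ≈⟨ sym (+-assoc _ _ _) ⟩
    ι F (n ℕ.+ n) + ι F n + - ι F n      ≈⟨ +-congʳ (sym (ι-+ (n ℕ.+ n) n)) ⟩
    ι F (n ℕ.+ n ℕ.+ n) + - ι F n        ≡⟨ ≡.cong (λ k → ι F k + - ι F n) (tripled n) ⟩
    ι F (3 ℕ.* n) + - ι F n              ≈⟨ +-congʳ (trans (ι-* 3 n) (trans (*-congʳ ι3≈0) (zeroˡ _))) ⟩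
    0# + - ι F n                         ≈⟨ +-identityˡ _ ⟩
    - ι F n                              ∎
    where
    tripled : ∀ n → n ℕ.+ n ℕ.+ n ≡ 3 ℕ.* n
    tripled = solve-∀

  -- ℤ/3 as a coefficient ring for the ring solver: residues 0,1,2 in ℕ.
  ℤ/3 : RawRing _ _
  ℤ/3 = record
    { Carrier = ℕ ; _≈_ = _≡_
    ; _+_ = λ m n → (m ℕ.+ n) % 3
    ; _*_ = λ m n → (m ℕ.* n) % 3
    ; -_  = λ n → (n ℕ.+ n) % 3
    ; 0#  = 0 ; 1# = 1 }

  -- Constants for the solver: n·1 as ι, but with 1 ↦ 1# on the nose, so that
  -- the constants con 1 and con 2 are literally 1# and two = 1# + 1#.
  const : ℕ → Carrier
  const zero          = 0#
  const (suc zero)    = 1#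
  const (suc (suc n)) = 1# + const (suc n)

  const≈ι : ∀ n → const n ≈ ι F n
  const≈ι zero          = refl
  const≈ι (suc zero)    = sym (+-identityʳ 1#)
  const≈ι (suc (suc n)) = +-congˡ (const≈ι (suc n))

  -- const is a ring homomorphism from ℤ/3, because 3·1 = 0 in F.
  const-hom : ℤ/3 ACR.-Raw-AlmostCommutative⟶ ACR.fromCommutativeRing cring
  const-hom = record
    { ⟦_⟧    = const
    ; +-homo = λ m n → via-ι (m ℕ.+ n) (ι-+ m n) (+-cong (const≈ι m) (const≈ι n))
    ; *-homo = λ m n → via-ι (m ℕ.* n) (ι-* m n) (*-cong (const≈ι m) (const≈ι n))
    ; -‿homo = λ n → via-ι (n ℕ.+ n) (ι-double n) (-‿cong (const≈ι n))
    ; 0-homo = refl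
    ; 1-homo = refl
    }
    where
    via-ι : ∀ k {u v} → ι F k ≈ u → v ≈ u → const (k % 3) ≈ v
    via-ι k ιk≈u v≈u = trans (const≈ι (k % 3)) (trans (ι-%3 k) (trans ιk≈u (sym v≈u)))

  coeff≟ : ∀ m n → Maybe (const m ≈ const n)
  coeff≟ m n with m ℕ.≟ n
  ... | yes ≡.refl = just refl
  ... | no  _      = nothing

  open import Algebra.Solver.Ring ℤ/3 (ACR.fromCommutativeRing cring) const-hom coeff≟
    using (solve; _:+_; _:*_; _:-_; _:=_; con) public

  two : Carrier
  two = 1# + 1#

  -- The formal extension F[√y]: the pair ⟨ a , b ⟩ stands for a + b√y.
  module Extension (y : Carrier) where

    record F[√y] : Set a where
      constructor ⟨_,_⟩
      field
        re im : Carrier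
    open F[√y] public

    infix  4 _≋_
    infixl 7 _·_

    _≋_ : F[√y] → F[√y] → Set ℓ
    u ≋ v = (re u ≈ re v) × (im u ≈ im v)

    ≋-setoid : Setoid a ℓ
    ≋-setoid = record
      { Carrier = F[√y] ; _≈_ = _≋_
      ; isEquivalence = record
        { refl  = refl , refl
        ; sym   = λ (e₁ , e₂) → sym e₁ , sym e₂
        ; trans = λ (e₁ , e₂) (f₁ , f₂) → trans e₁ f₁ , trans e₂ f₂ } }

    open Setoid ≋-setoid public using ()
      renaming (refl to ≋-refl; sym to ≋-sym; trans to ≋-trans; reflexive to ≋-reflexive)

    _·_ : F[√y] → F[√y] → F[√y]
    ⟨ a , b ⟩ · ⟨ a′ , b′ ⟩ = ⟨ a * a′ + y * (b * b′) , a * b′ + b * a′ ⟩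

    ·-cong : ∀ {u u′ v v′} → u ≋ u′ → v ≋ v′ → u · v ≋ u′ · v′
    ·-cong (a , b) (a′ , b′) =
      +-cong (*-cong a a′) (*-congˡ (*-cong b b′)) , +-cong (*-cong a b′) (*-cong b a′)

    ·-identityˡ : ∀ u → ⟨ 1# , 0# ⟩ · u ≋ u
    ·-identityˡ ⟨ a , b ⟩ =
      solve 3 (λ a b y → con 1 :* a :+ y :* (con 0 :* b) := a) refl a b y ,
      solve 2 (λ a b → con 1 :* b :+ con 0 :* a := b) refl a b

    ·-assoc : ∀ u v w → u · (v · w) ≋ (u · v) · w
    ·-assoc ⟨ a , b ⟩ ⟨ c′ , d ⟩ ⟨ e , f ⟩ =
      solve 7 (λ a b c d e f y →
          a :* (c :* e :+ y :* (d :* f)) :+ y :* (b :* (c :* f :+ d :* e))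
        := (a :* c :+ y :* (b :* d)) :* e :+ y :* ((a :* d :+ b :* c) :* f))
        refl a b c′ d e f y ,
      solve 7 (λ a b c d e f y →
          a :* (c :* f :+ d :* e) :+ b :* (c :* e :+ y :* (d :* f))
        := (a :* c :+ y :* (b :* d)) :* f :+ (a :* d :+ b :* c) :* e)
        refl a b c′ d e f y

    cube : ∀ a b → ⟨ a , b ⟩ · (⟨ a , b ⟩ · ⟨ a , b ⟩) ≋ ⟨ a * (a * a) , y * (b * (b * b)) ⟩
    cube a b =
      solve 3 (λ a b y →
          a :* (a :* a :+ y :* (b :* b)) :+ y :* (b :* (a :* b :+ b :* a)) := a :* (a :* a))
        refl a b y ,
      solve 3 (λ a b y →
          a :* (a :* b :+ b :* a) :+ b :* (a :* a :+ y :* (b :* b)) := y :* (b :* (b :* b)))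
        refl a b y

    -- α = 2 + 2√y (a root of T² - T + x with y = 1 - x) and its powers.
    α : F[√y]
    α = ⟨ two , two ⟩

    α^ : ℕ → F[√y]
    α^ zero    = ⟨ 1# , 0# ⟩
    α^ (suc m) = α · α^ m

    α^-+ : ∀ m n → α^ (m ℕ.+ n) ≋ α^ m · α^ n
    α^-+ zero    n = ≋-sym (·-identityˡ (α^ n))
    α^-+ (suc m) n = ≋-trans (·-cong ≋-refl (α^-+ m n)) (·-assoc α (α^ m) (α^ n))

    α^-3* : ∀ n → α^ (3 ℕ.* n) ≋ α^ n · (α^ n · α^ n)
    α^-3* n = ≋-trans (≋-reflexive (≡.cong α^ (three-times n)))
      (≋-trans (α^-+ n (n ℕ.+ n)) (·-cong ≋-refl (α^-+ n n)))

    α^pow3 : ∀ l → α^ (3 ^ l) ≋ ⟨ two , two * pow F y (halfExp l) ⟩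
    α^pow3 zero    =
      solve 1 (λ y → con 2 :* con 1 :+ y :* (con 2 :* con 0) := con 2) refl y ,
      solve 0 (con 2 :* con 0 :+ con 2 :* con 1 := con 2 :* con 1) refl
    α^pow3 (suc l) =
      ≋-trans (α^-3* (3 ^ l)) (≋-trans (·-cong IH (·-cong IH IH))
        (≋-trans (cube two (two * c)) simplify))
      where
      h : ℕ
      h = halfExp l
      c : Carrier
      c = pow F y h
      IH : α^ (3 ^ l) ≋ ⟨ two , two * c ⟩
      IH = α^pow3 l
      c³ : pow F y (3 ℕ.* h) ≈ c * (c * c)
      c³ = trans (reflexive (≡.cong (pow F y) (three-times h)))
             (trans (pow-+ y h (h ℕ.+ h)) (*-congˡ (pow-+ y h h)))
      simplify : ⟨ two * (two * two) , y * (two * c * (two * c * (two * c))) ⟩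
               ≋ ⟨ two , two * pow F y (halfExp (suc l)) ⟩
      simplify =
        solve 0 (con 2 :* (con 2 :* con 2) := con 2) refl ,
        trans (solve 2 (λ y c → y :* (con 2 :* c :* (con 2 :* c :* (con 2 :* c)))
                             := con 2 :* (y :* (c :* (c :* c)))) refl y c)
              (*-congˡ (*-congˡ (sym c³)))

    im-triple : ∀ c₁ c₂ c₃ →
      two * im (⟨ two , two * c₁ ⟩ · ⟨ two , two * c₂ ⟩ · ⟨ two , two * c₃ ⟩)
      ≈ y * (c₁ * c₂ * c₃) + c₁ + c₂ + c₃
    im-triple c₁ c₂ c₃ = solve 4 (λ y a b c →
        con 2 :* ((con 2 :* con 2 :+ y :* (con 2 :* a :* (con 2 :* b))) :* (con 2 :* c)
                  :+ (con 2 :* (con 2 :* b) :+ con 2 :* a :* con 2) :* con 2)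
      := y :* (a :* b :* c) :+ a :+ b :+ c) refl y c₁ c₂ c₃

  a_ b_ : Carrier → ℕ → Carrier
  a_ x m = Extension.F[√y].re (Extension.α^ (1# - x) m)
  b_ x m = Extension.F[√y].im (Extension.α^ (1# - x) m)

  D-binet : ∀ x m → D F m 2 x ≈ two * b_ x m
  D-binet x zero          = trans (-‿inverseʳ _) (sym (zeroʳ _))
  D-binet x (suc zero)    = solve 0 (con 1 := con 2 :* (con 2 :* con 0 :+ con 2 :* con 1)) refl
  D-binet x (suc (suc m)) =
    trans (+-cong (D-binet x (suc m)) (-‿cong (*-congˡ (D-binet x m))))
          (recurrence (a_ x m) (b_ x m))
    where
    recurrence : ∀ a b → two * (two * b + two * a) - x * (two * b)
      ≈ two * (two * (two * b + two * a) + two * (two * a + (1# - x) * (two * b)))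
    recurrence a b = solve 3 (λ a b x →
        con 2 :* (con 2 :* b :+ con 2 :* a) :- x :* (con 2 :* b)
      := con 2 :* (con 2 :* (con 2 :* b :+ con 2 :* a)
                   :+ con 2 :* (con 2 :* a :+ (con 1 :- x) :* (con 2 :* b)))) refl a b x

  D≈g∘reflect : ∀ l₁ l₂ l₃ x →
    D F (3 ^ l₁ ℕ.+ 3 ^ l₂ ℕ.+ 3 ^ l₃) 2 x ≈ g F l₁ l₂ l₃ (1# - x)
  D≈g∘reflect l₁ l₂ l₃ x = begin
    D F (N₁ ℕ.+ N₂ ℕ.+ N₃) 2 x                      ≈⟨ D-binet x (N₁ ℕ.+ N₂ ℕ.+ N₃) ⟩
    two * b_ x (N₁ ℕ.+ N₂ ℕ.+ N₃)                   ≈⟨ *-congˡ (proj₂ split) ⟩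
    two * im (P c₁ · P c₂ · P c₃)                   ≈⟨ im-triple c₁ c₂ c₃ ⟩
    y * (c₁ * c₂ * c₃) + c₁ + c₂ + c₃               ≈⟨ +-cong (+-cong (+-cong leading (e l₁)) (e l₂)) (e l₃) ⟩
    g F l₁ l₂ l₃ y                                  ∎
    where
    open Extension (1# - x)
    y : Carrier
    y = 1# - x
    N₁ N₂ N₃ : ℕ
    N₁ = 3 ^ l₁
    N₂ = 3 ^ l₂
    N₃ = 3 ^ l₃
    c₁ c₂ c₃ : Carrier
    c₁ = pow F y (halfExp l₁)
    c₂ = pow F y (halfExp l₂)
    c₃ = pow F y (halfExp l₃)
    P : Carrier → F[√y]
    P c = ⟨ two , two * c ⟩
    split : α^ (N₁ ℕ.+ N₂ ℕ.+ N₃) ≋ P c₁ · P c₂ · P c₃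
    split = ≋-trans (α^-+ (N₁ ℕ.+ N₂) N₃)
      (·-cong (≋-trans (α^-+ N₁ N₂) (·-cong (α^pow3 l₁) (α^pow3 l₂))) (α^pow3 l₃))
    e : ∀ l → pow F y (halfExp l) ≈ pow F y ((3 ^ l ℕ.∸ 1) / 2)
    e l = reflexive (≡.cong (pow F y) (≡.sym (halfExp-correct l)))
    leading : y * (c₁ * c₂ * c₃) ≈ pow F y ((N₁ ℕ.+ N₂ ℕ.+ N₃ ℕ.∸ 1) / 2)
    leading = begin
      y * (c₁ * c₂ * c₃)
        ≈⟨ *-congˡ (sym (trans (pow-+ y (halfExp l₁ ℕ.+ halfExp l₂) (halfExp l₃))
                               (*-congʳ (pow-+ y (halfExp l₁) (halfExp l₂))))) ⟩
      pow F y (suc (halfExp l₁ ℕ.+ halfExp l₂ ℕ.+ halfExp l₃))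
        ≡⟨ ≡.cong (pow F y) (≡.sym (halfExp-sum l₁ l₂ l₃)) ⟩
      pow F y ((N₁ ℕ.+ N₂ ℕ.+ N₃ ℕ.∸ 1) / 2) ∎

  reflect-involutive : ∀ x → 1# - (1# - x) ≈ x
  reflect-involutive = solve 1 (λ x → con 1 :- (con 1 :- x) := x) refl

open import Data.Nat using (_+_)

mainTheorem13 : ∀ {c ℓ : Level} (e : ℕ) → e ≥ 1 → (F : FiniteFieldOfOrder c ℓ (3 ^ e))
    → (l₁ l₂ l₃ : ℕ) → l₁ ≥ 1 → l₂ ≥ 1 → l₃ ≥ 1
    → IsPermutationPolynomial F (D F (3 ^ l₁ + 3 ^ l₂ + 3 ^ l₃) 2)
      ⇔ IsPermutationPolynomial F (g F l₁ l₂ l₃)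
mainTheorem13 e _ F l₁ l₂ l₃ _ _ _ = begin
  IsPermutationPolynomial F (D F (3 ^ l₁ ℕ.+ 3 ^ l₂ ℕ.+ 3 ^ l₃) 2)
    ≈⟨ bijective-resp-≗ (D≈g∘reflect l₁ l₂ l₃) ⟩
  Bijective _≈_ _≈_ (g F l₁ l₂ l₃ ∘ (1# -_))
    ≈⟨ bijective-∘-involution (g-cong l₁ l₂ l₃) (+-congˡ ∘ -‿cong) reflect-involutive ⟩
  IsPermutationPolynomial F (g F l₁ l₂ l₃) ∎
  where
  open FiniteFieldOfOrder F using (setoid; _≈_; 1#; _-_; +-congˡ; -‿cong)
  open FieldFacts F using (characteristic; g-cong)
  open Characteristic3 F (characteristic 3 e ≡.refl)
  open Bijections setoid
  open import Function.Properties.Equivalence using (⇔-setoid)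
  open import Relation.Binary.Reasoning.Setoid (⇔-setoid _)
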